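{- If there exists a finite nonempty digraph with no loops, multiple edges or digons that has no satisfactory vertex, then there exist infinitely many pairwise non-isomorphic strongly connected such digraphs (finite, nonempty, with no loops, multiple edges or digons) having no satisfactory vertex.
   Context: A digon is a pair of edges $(u,v),(v,u)$. For a vertex $u$ and positive integer $i$, $N_i(u)=\{v : \mathrm{dist}(u,v)=i\}$, where $\mathrm{dist}(u,v)$ is the length of a shortest directed path from $u$ to $v$ ($\infty$ if none). A vertex $u$ is satisfactory if $|N_1(u)|\le|N_2(u)|$. -}

module Defs where

open import Data.Nat using (ℕ; zero; suc; _+_; _≤_; _<_)
open import Data.Bool using (Bool; true; false; _∧_; _∨_; not; T)
open import Data.Fin using (Fin; zero; suc)
open import Data.Fin.Properties using (_≟_)
open import Relation.Nullary.Decidable using (⌊_⌋)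
open import Relation.Nullary using (¬_)
open import Relation.Binary.PropositionalEquality using (_≡_)
open import Data.Product using (Σ; ∃; _×_)
open import Function.Bundles using (_↔_; Inverse)

-- A finite digraph on vertex set Fin n, given by its adjacency relation.
-- A Bool-valued adjacency relation has no multiple edges by construction.
record Digraph : Set where
  constructor mkDigraph
  field
    size : ℕ
    edge : Fin size → Fin size → Bool

open Digraph public

anyFin : ∀ {n} → (Fin n → Bool) → Bool
anyFin {zero}  p = false
anyFin {suc n} p = p zero ∨ anyFin (λ i → p (suc i))

countFin : ∀ {n} → (Fin n → Bool) → ℕ
countFin {zero}  p = 0
countFin {suc n} p = (if p zero then 1 else 0) + countFin (λ i → p (suc i))
  where open import Data.Bool using (if_then_else_)

walk : (G : Digraph) → ℕ → Fin (size G) → Fin (size G) → Bool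
walk G zero    u v = ⌊ u ≟ v ⌋
walk G (suc k) u v = anyFin (λ w → edge G u w ∧ walk G k w v)

walkBelow : (G : Digraph) → ℕ → Fin (size G) → Fin (size G) → Bool
walkBelow G zero    u v = false
walkBelow G (suc i) u v = walkBelow G i u v ∨ walk G i u v

-- dist(u,v) = i  (shortest directed walk, equivalently path, has length i)
distIs : (G : Digraph) → Fin (size G) → Fin (size G) → ℕ → Bool
distIs G u v i = walk G i u v ∧ not (walkBelow G i u v)

nbhdSize : (G : Digraph) → ℕ → Fin (size G) → ℕ
nbhdSize G i u = countFin (λ v → distIs G u v i)

Satisfactory : (G : Digraph) → Fin (size G) → Set
Satisfactory G u = nbhdSize G 1 u ≤ nbhdSize G 2 u

NoSatisfactoryVertex : Digraph → Set
NoSatisfactoryVertex G = ∀ u → ¬ Satisfactory G u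

Nonempty : Digraph → Set
Nonempty G = 0 < size G

Loopless : Digraph → Set
Loopless G = ∀ u → edge G u u ≡ false

NoDigons : Digraph → Set
NoDigons G = ∀ u v → ¬ (T (edge G u v) × T (edge G v u))

StronglyConnected : Digraph → Set
StronglyConnected G = ∀ u v → ∃ λ k → T (walk G k u v)

-- finite, nonempty, no loops, no multiple edges (built in), no digons
Admissible : Digraph → Set
Admissible G = Nonempty G × Loopless G × NoDigons G

Isomorphic : Digraph → Digraph → Set
Isomorphic G H =
  Σ (Fin (size G) ↔ Fin (size H)) λ f →
    ∀ u v → edge G u v ≡ edge H (Inverse.to f u) (Inverse.to f v)

module Submission where

-- Pick a vertex r whose reachable set R(r) is as small as
-- possible.  Every vertex u of P = R(r) reaches r back: otherwise R(u) would
-- be a proper subset of R(r).  So P is closed under out-edges and strongly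
-- connected.
--
-- For k ≥ 1 replace every vertex of P by k independent copies, two
-- copies being adjacent iff their originals are.  Walks of positive length in
-- the blow-up are exactly the lifts of walks of G inside P.  As G has no
-- closed walk of length 1 or 2 (no loops, no digons), two copies of one vertex
-- are never at distance 1 or 2, hence |N₁| and |N₂| of every copy are k times
-- those of its original: no copy is satisfactory.  The blow-up is strongly
-- connected and has k·|P| vertices, so different k give non-isomorphic graphs.

open import Defs
open import Data.Nat using (ℕ; zero; suc; _+_; _*_; _≤_; _<_; z≤n; s≤s; >-nonZero)
open import Data.Nat.Properties
  using (≤-refl; ≤-trans; ≤-totalOrder; m≤n⇒m≤1+n; m≤n+m; 1+n≰n; ≰⇒>; m<1+n⇒m<n∨m≡n;
         +-comm; +-assoc; *-zeroʳ; *-distribˡ-+; *-mono-≤; *-cancelˡ-≤; *-cancelʳ-≡;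
         suc-injective)
open import Data.Bool using (Bool; true; false; _∧_; _∨_; not; T; if_then_else_)
open import Data.Bool.Properties using (T-∧; T-∨; ∧-identityʳ; ∧-inverseʳ)
open import Data.Fin using (Fin; zero; suc; fromℕ<)
open import Data.Fin.Properties using (_≟_)
open import Data.Fin.Permutation using (↔⇒≡)
open import Data.List using (List; []; _∷_; _++_; map; replicate; length; lookup; allFin)
import Data.List.Relation.Unary.All as All
open import Data.List.Membership.Propositional.Properties using (∈-allFin)
import Data.List.Extrema
open import Data.Product using (Σ; ∃; _×_; _,_; proj₁; proj₂)
open import Data.Sum using (_⊎_; inj₁; inj₂)
open import Data.Empty using (⊥-elim)
open import Data.Unit using (tt)
open import Function using (_∘_)
open import Function.Bundles using (Equivalence)
open import Relation.Nullary using (¬_; yes; no)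
open import Relation.Nullary.Decidable using (⌊_⌋; toWitness; fromWitness)
open import Relation.Binary.PropositionalEquality
  using (_≡_; refl; sym; trans; cong; cong₂; subst; subst₂; module ≡-Reasoning)

open Equivalence using (to; from)

T-ext : ∀ {a b : Bool} → (T a → T b) → (T b → T a) → a ≡ b
T-ext {false} {false} _ _ = refl
T-ext {false} {true}  _ g = ⊥-elim (g tt)
T-ext {true}  {false} f _ = ⊥-elim (f tt)
T-ext {true}  {true}  _ _ = refl

T-not : ∀ {b} → T (not b) → ¬ T b
T-not {false} _ ()

T-∧-not : ∀ {a b} → T a → ¬ T (a ∧ not b) → T b
T-∧-not {true} {false} _ n = ⊥-elim (n tt)
T-∧-not {true} {true}  _ _ = tt

≟-false : ∀ {n} {x y : Fin n} → ¬ x ≡ y → ⌊ x ≟ y ⌋ ≡ false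
≟-false {x = x} {y} x≢y with x ≟ y
... | yes x≡y = ⊥-elim (x≢y x≡y)
... | no  _   = refl

anyFin-intro : ∀ {n} (p : Fin n → Bool) (x : Fin n) → T (p x) → T (anyFin p)
anyFin-intro {suc n} p zero    h = from T-∨ (inj₁ h)
anyFin-intro {suc n} p (suc x) h = from (T-∨ {p zero}) (inj₂ (anyFin-intro (p ∘ suc) x h))

anyFin-elim : ∀ {n} (p : Fin n → Bool) → T (anyFin p) → ∃ λ x → T (p x)
anyFin-elim {suc n} p h with to (T-∨ {p zero}) h
... | inj₁ h₀ = zero , h₀
... | inj₂ hs with anyFin-elim (p ∘ suc) hs
...   | x , hx = suc x , hx

count-cong : ∀ {n} {p q : Fin n → Bool} → (∀ x → p x ≡ q x) → countFin p ≡ countFin q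
count-cong {zero}  e = refl
count-cong {suc n} e = cong₂ _+_ (cong (λ b → if b then 1 else 0) (e zero)) (count-cong (e ∘ suc))

count-≤-size : ∀ {n} (p : Fin n → Bool) → countFin p ≤ n
count-≤-size {zero}  p = z≤n
count-≤-size {suc n} p with p zero
... | true  = s≤s (count-≤-size (p ∘ suc))
... | false = m≤n⇒m≤1+n (count-≤-size (p ∘ suc))

count-true : ∀ n → countFin {n} (λ _ → true) ≡ n
count-true zero    = refl
count-true (suc n) = cong suc (count-true n)

count-false : ∀ n → countFin {n} (λ _ → false) ≡ 0
count-false zero    = refl
count-false (suc n) = count-false n

count-mono : ∀ {n} (p q : Fin n → Bool) → (∀ x → T (p x) → T (q x)) → countFin p ≤ countFin q
count-mono {zero}  p q p⊆q = z≤n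
count-mono {suc n} p q p⊆q with p zero | q zero | p⊆q zero
... | true  | true  | _ = s≤s (count-mono (p ∘ suc) (q ∘ suc) (p⊆q ∘ suc))
... | false | true  | _ = m≤n⇒m≤1+n (count-mono (p ∘ suc) (q ∘ suc) (p⊆q ∘ suc))
... | false | false | _ = count-mono (p ∘ suc) (q ∘ suc) (p⊆q ∘ suc)
... | true  | false | h = ⊥-elim (h tt)

count-strict : ∀ {n} (p q : Fin n → Bool) → (∀ x → T (p x) → T (q x)) →
               (y : Fin n) → T (q y) → ¬ T (p y) → suc (countFin p) ≤ countFin q
count-strict {suc n} p q p⊆q zero qy ¬py with p zero | q zero | p⊆q zero
... | true  | _     | _ = ⊥-elim (¬py tt)
... | false | true  | _ = s≤s (count-mono (p ∘ suc) (q ∘ suc) (p⊆q ∘ suc))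
... | false | false | _ = ⊥-elim qy
count-strict {suc n} p q p⊆q (suc y) qy ¬py with p zero | q zero | p⊆q zero
... | true  | true  | _ = s≤s (count-strict (p ∘ suc) (q ∘ suc) (p⊆q ∘ suc) y qy ¬py)
... | false | true  | _ = m≤n⇒m≤1+n (count-strict (p ∘ suc) (q ∘ suc) (p⊆q ∘ suc) y qy ¬py)
... | false | false | _ = count-strict (p ∘ suc) (q ∘ suc) (p⊆q ∘ suc) y qy ¬py
... | true  | false | h = ⊥-elim (h tt)

count-pos : ∀ {n} (p : Fin n → Bool) (y : Fin n) → T (p y) → 1 ≤ countFin p
count-pos {suc n} p zero h with p zero
... | true = s≤s z≤n
count-pos {suc n} p (suc y) h =
  ≤-trans (count-pos (p ∘ suc) y h) (m≤n+m _ (if p zero then 1 else 0))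

count-witness : ∀ {n} (p : Fin n → Bool) → 1 ≤ countFin p → ∃ λ x → T (p x)
count-witness {suc n} p h with p zero in eq
... | true  = zero , subst T (sym eq) tt
... | false with count-witness (p ∘ suc) h
...   | x , hx = suc x , hx

-- Counting the entries of a list satisfying q; the vertex sets of the
-- blow-ups are lists, and this is how their neighbourhoods are counted.
listCount : ∀ {A : Set} → (A → Bool) → List A → ℕ
listCount q []      = 0
listCount q (a ∷ l) = (if q a then 1 else 0) + listCount q l

count-lookup : ∀ {A : Set} (q : A → Bool) (l : List A) →
               countFin (q ∘ lookup l) ≡ listCount q l
count-lookup q []      = refl
count-lookup q (a ∷ l) = cong ((if q a then 1 else 0) +_) (count-lookup q l)

listCount-++ : ∀ {A : Set} (q : A → Bool) (l m : List A) →
               listCount q (l ++ m) ≡ listCount q l + listCount q m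
listCount-++ q []      m = refl
listCount-++ q (a ∷ l) m =
  trans (cong ((if q a then 1 else 0) +_) (listCount-++ q l m))
        (sym (+-assoc (if q a then 1 else 0) _ _))

listCount-map : ∀ {A B : Set} (q : B → Bool) (f : A → B) (l : List A) →
                listCount q (map f l) ≡ listCount (q ∘ f) l
listCount-map q f []      = refl
listCount-map q f (a ∷ l) = cong ((if q (f a) then 1 else 0) +_) (listCount-map q f l)

listCount-replicate : ∀ {A : Set} (q : A → Bool) k (a : A) →
                      listCount q (replicate k a) ≡ k * (if q a then 1 else 0)
listCount-replicate q zero    a = refl
listCount-replicate q (suc k) a = cong ((if q a then 1 else 0) +_) (listCount-replicate q k a)

copies : ∀ {n} → ℕ → (Fin n → Bool) → List (Fin n)
copies {zero}  k P = []
copies {suc n} k P = (if P zero then replicate k zero else []) ++ map suc (copies k (P ∘ suc))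

listCount-copies : ∀ {n} k (P q : Fin n → Bool) →
                   listCount q (copies k P) ≡ k * countFin (λ w → P w ∧ q w)
listCount-copies {zero}  k P q = sym (*-zeroʳ k)
listCount-copies {suc n} k P q =
  begin
    listCount q (copies k P)
  ≡⟨ listCount-++ q (if P zero then replicate k zero else []) _ ⟩
    listCount q (if P zero then replicate k zero else []) + listCount q (map suc (copies k (P ∘ suc)))
  ≡⟨ cong₂ _+_ (first-block (P zero))
               (trans (listCount-map q suc (copies k (P ∘ suc))) (listCount-copies k (P ∘ suc) (q ∘ suc))) ⟩
    k * (if P zero ∧ q zero then 1 else 0) + k * countFin (λ w → P (suc w) ∧ q (suc w))
  ≡⟨ sym (*-distribˡ-+ k _ _) ⟩
    k * countFin (λ w → P w ∧ q w)
  ∎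
  where
  open ≡-Reasoning
  first-block : ∀ b → listCount q (if b then replicate k zero else []) ≡ k * (if b ∧ q zero then 1 else 0)
  first-block true  = listCount-replicate q k zero
  first-block false = sym (*-zeroʳ k)

module Walks (G : Digraph) where

  V : Set
  V = Fin (size G)

  walk-refl : (u : V) → T (walk G 0 u u)
  walk-refl u = fromWitness {a? = u ≟ u} refl

  walk-zero : ∀ {u v : V} → T (walk G 0 u v) → u ≡ v
  walk-zero {u} {v} h = toWitness {a? = u ≟ v} h

  walk-cons : ∀ k {u w v : V} → T (edge G u w) → T (walk G k w v) → T (walk G (suc k) u v)
  walk-cons k {u} {w} {v} e h = anyFin-intro (λ x → edge G u x ∧ walk G k x v) w (from T-∧ (e , h))

  walk-uncons : ∀ k {u v : V} → T (walk G (suc k) u v) → ∃ λ w → T (edge G u w) × T (walk G k w v)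
  walk-uncons k {u} {v} h with anyFin-elim (λ x → edge G u x ∧ walk G k x v) h
  ... | w , ew = w , to T-∧ ew

  walk-edge : ∀ {u v : V} → T (edge G u v) → T (walk G 1 u v)
  walk-edge {v = v} e = walk-cons 0 e (walk-refl v)

  walk-concat : ∀ j k {u w v : V} → T (walk G j u w) → T (walk G k w v) → T (walk G (j + k) u v)
  walk-concat zero    k h₁ h₂ rewrite walk-zero h₁ = h₂
  walk-concat (suc j) k h₁ h₂ with walk-uncons j h₁
  ... | x , e , h = walk-cons (j + k) e (walk-concat j k h h₂)

  walk-split : ∀ j k {u v : V} → T (walk G (j + k) u v) → ∃ λ w → T (walk G j u w) × T (walk G k w v)
  walk-split zero    k {u} h = u , walk-refl u , h
  walk-split (suc j) k h with walk-uncons (j + k) h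
  ... | x , e , h′ with walk-split j k h′
  ...   | w , h₁ , h₂ = w , walk-cons j e h₁ , h₂

  walk-snoc : ∀ i {u w v : V} → T (walk G i u w) → T (edge G w v) → T (walk G (suc i) u v)
  walk-snoc i {u} {w} {v} h e =
    subst (λ m → T (walk G m u v)) (+-comm i 1) (walk-concat i 1 h (walk-edge e))

  walk-unsnoc : ∀ k {u v : V} → T (walk G (suc k) u v) → ∃ λ w → T (walk G k u w) × T (edge G w v)
  walk-unsnoc k {u} {v} h with walk-split k 1 (subst (λ m → T (walk G m u v)) (+-comm 1 k) h)
  ... | w , h₁ , h₂ with walk-uncons 0 h₂
  ...   | x , e , h₀ rewrite walk-zero h₀ = w , h₁ , e

  walkBelow-elim : ∀ j {u v : V} → T (walkBelow G j u v) → ∃ λ i → i < j × T (walk G i u v)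
  walkBelow-elim (suc j) {u} {v} h with to (T-∨ {walkBelow G j u v}) h
  ... | inj₂ hj = j , ≤-refl , hj
  ... | inj₁ hb with walkBelow-elim j hb
  ...   | i , i<j , hi = i , m≤n⇒m≤1+n i<j , hi

  walkBelow-intro : ∀ {j i} {u v : V} → i < j → T (walk G i u v) → T (walkBelow G j u v)
  walkBelow-intro {suc j} {i} {u} {v} i<1+j h with m<1+n⇒m<n∨m≡n i<1+j
  ... | inj₁ i<j  = from (T-∨ {walkBelow G j u v}) (inj₁ (walkBelow-intro i<j h))
  ... | inj₂ refl = from (T-∨ {walkBelow G j u v}) (inj₂ h)

  Stable : V → ℕ → Set
  Stable u j = ∀ v → T (walkBelow G (suc j) u v) → T (walkBelow G j u v)

  stable-closed : ∀ u j → Stable u j → ∀ k {v} → T (walk G k u v) → T (walkBelow G j u v)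
  stable-closed u zero    st k       h = ⊥-elim (st u (walk-refl u))
  stable-closed u (suc j) st zero    h = walkBelow-intro {suc j} (s≤s z≤n) h
  stable-closed u (suc j) st (suc k) h with walk-unsnoc k h
  ... | w , hw , e with walkBelow-elim (suc j) (stable-closed u (suc j) st k hw)
  ...   | i , i<j , hi = st _ (walkBelow-intro (s≤s i<j) (walk-snoc i hi e))

  firstReachedAt : V → ℕ → V → Bool
  firstReachedAt u j v = walkBelow G (suc j) u v ∧ not (walkBelow G j u v)

  stable-or-grows : ∀ u j → Stable u j ⊎ suc (countFin (walkBelow G j u)) ≤ countFin (walkBelow G (suc j) u)
  stable-or-grows u j with anyFin (firstReachedAt u j) in eq
  ... | true with anyFin-elim (firstReachedAt u j) (subst T (sym eq) tt)
  ...   | v , hv with to (T-∧ {walkBelow G (suc j) u v}) hv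
  ...     | below , notBefore =
    inj₂ (count-strict (walkBelow G j u) (walkBelow G (suc j) u)
                       (λ x h → from (T-∨ {walkBelow G j u x}) (inj₁ h)) v below (T-not notBefore))
  stable-or-grows u j | false =
    inj₁ λ v h → T-∧-not h (λ hv → subst T eq (anyFin-intro (firstReachedAt u j) v hv))

  stabilises : ∀ u j → Σ ℕ (Stable u) ⊎ j ≤ countFin (walkBelow G j u)
  stabilises u zero = inj₂ z≤n
  stabilises u (suc j) with stabilises u j
  ... | inj₁ s  = inj₁ s
  ... | inj₂ le with stable-or-grows u j
  ...   | inj₁ st = inj₁ (j , st)
  ...   | inj₂ gr = inj₂ (≤-trans (s≤s le) gr)

  -- Since at most |V| vertices can be reached, the walk sets stabilise.
  stableLength : (u : V) → Σ ℕ (Stable u)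
  stableLength u with stabilises u (suc (size G))
  ... | inj₁ s  = s
  ... | inj₂ le = ⊥-elim (1+n≰n (≤-trans le (count-≤-size (walkBelow G (suc (size G)) u))))

  Reach : V → V → Bool
  Reach u = walkBelow G (proj₁ (stableLength u)) u

  reach-elim : ∀ {u v} → T (Reach u v) → ∃ λ k → T (walk G k u v)
  reach-elim {u} h with walkBelow-elim (proj₁ (stableLength u)) h
  ... | i , _ , hi = i , hi

  reach-intro : ∀ k {u v} → T (walk G k u v) → T (Reach u v)
  reach-intro k {u} = stable-closed u (proj₁ (stableLength u)) (proj₂ (stableLength u)) k

open Walks

module SinkComponent (G : Digraph) (x₀ : Fin (size G)) where

  private
    reachCount : Fin (size G) → ℕ
    reachCount u = countFin (Reach G u)

    open Data.List.Extrema ≤-totalOrder using (argmin; f[argmin]≤f[xs])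

  r : Fin (size G)
  r = argmin reachCount x₀ (allFin (size G))

  r-minimal : ∀ v → reachCount r ≤ reachCount v
  r-minimal v = All.lookup (f[argmin]≤f[xs] x₀ (allFin (size G))) (∈-allFin v)

  P : Fin (size G) → Bool
  P = Reach G r

  r∈P : T (P r)
  r∈P = reach-intro G 0 (walk-refl G r)

  P-closed : ∀ k {u v} → T (P u) → T (walk G k u v) → T (P v)
  P-closed k u∈P h with reach-elim G u∈P
  ... | k′ , h′ = reach-intro G (k′ + k) (walk-concat G k′ k h′ h)

  -- Every vertex of P reaches r: its reachable set lies inside P, so by
  -- minimality it cannot miss r.
  P-returns : ∀ {u} → T (P u) → ∃ λ k → T (walk G k u r)
  P-returns {u} u∈P with Reach G u r in eq
  ... | true  = reach-elim G (subst T (sym eq) tt)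
  ... | false = ⊥-elim (1+n≰n (≤-trans smaller (r-minimal u)))
    where
    smaller : suc (reachCount u) ≤ reachCount r
    smaller = count-strict (Reach G u) P
                (λ v h → P-closed (proj₁ (reach-elim G h)) u∈P (proj₂ (reach-elim G h)))
                r r∈P (subst T eq)

  P-strong : ∀ {u v} → T (P u) → T (P v) → ∃ λ k → T (walk G k u v)
  P-strong u∈P v∈P with P-returns u∈P | reach-elim G v∈P
  ... | k₁ , h₁ | k₂ , h₂ = k₁ + k₂ , walk-concat G k₁ k₂ h₁ h₂

NoClosedWalk : Digraph → ℕ → Set
NoClosedWalk G n = ∀ u → ¬ T (walk G n u u)

loopless-closed : ∀ {G} → Loopless G → NoClosedWalk G 1
loopless-closed {G} loopless u h with walk-uncons G 0 h
... | w , e , h₀ rewrite walk-zero G h₀ = subst T (loopless u) e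

noDigons-closed : ∀ {G} → NoDigons G → NoClosedWalk G 2
noDigons-closed {G} noDigons u h with walk-uncons G 1 h
... | w , e , h₁ with walk-uncons G 0 h₁
...   | x , e′ , h₀ rewrite walk-zero G h₀ = noDigons u w (e , e′)

module BlowUp (G : Digraph) (P : Fin (size G) → Bool)
              (P-closed : ∀ k {u v} → T (P u) → T (walk G k u v) → T (P v))
              (k : ℕ) where

  L : List (Fin (size G))
  L = copies (suc k) P

  φ : Fin (length L) → Fin (size G)
  φ = lookup L

  F : Digraph
  F = mkDigraph (length L) (λ a b → edge G (φ a) (φ b))

  count-copies : ∀ q → countFin (q ∘ φ) ≡ suc k * countFin (λ w → P w ∧ q w)
  count-copies q = trans (count-lookup q L) (listCount-copies (suc k) P q)

  size-F : size F ≡ suc k * countFin P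
  size-F = begin
    length L                                 ≡⟨ sym (count-true (length L)) ⟩
    countFin {length L} (λ _ → true)          ≡⟨ count-copies (λ _ → true) ⟩
    suc k * countFin (λ w → P w ∧ true)      ≡⟨ cong (suc k *_) (count-cong (λ w → ∧-identityʳ (P w))) ⟩
    suc k * countFin P                       ∎
    where open ≡-Reasoning

  φ-in-P : ∀ a → T (P (φ a))
  φ-in-P a with P (φ a) in eq
  ... | true  = tt
  ... | false = ⊥-elim (1+n≰n (subst (1 ≤_) none (count-pos (not ∘ P ∘ φ) a (subst (T ∘ not) (sym eq) tt))))
    where
    none : countFin (not ∘ P ∘ φ) ≡ 0
    none = trans (count-copies (not ∘ P))
                 (trans (cong (suc k *_) (trans (count-cong (∧-inverseʳ ∘ P)) (count-false (size G))))
                        (*-zeroʳ (suc k)))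

  φ-onto : ∀ {w} → T (P w) → ∃ λ a → φ a ≡ w
  φ-onto {w} w∈P with count-witness (λ a → ⌊ φ a ≟ w ⌋) (subst (1 ≤_) (sym (count-copies (λ x → ⌊ x ≟ w ⌋))) many)
    where
    many : 1 ≤ suc k * countFin (λ x → P x ∧ ⌊ x ≟ w ⌋)
    many = *-mono-≤ {1} {suc k} (s≤s z≤n)
             (count-pos (λ x → P x ∧ ⌊ x ≟ w ⌋) w (from (T-∧ {P w}) (w∈P , fromWitness {a? = w ≟ w} refl)))
  ... | a , h = a , toWitness {a? = φ a ≟ w} h

  walk-project : ∀ j {a b} → T (walk F j a b) → T (walk G j (φ a) (φ b))
  walk-project zero    h rewrite walk-zero F h = walk-refl G _
  walk-project (suc j) h with walk-uncons F j h
  ... | x , e , h′ = walk-cons G j e (walk-project j h′)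

  -- Walks of positive length lift, as all their vertices lie in P.
  walk-lift : ∀ j {a b} → T (walk G (suc j) (φ a) (φ b)) → T (walk F (suc j) a b)
  walk-lift zero {a} {b} h with walk-uncons G 0 h
  ... | w , e , h₀ rewrite walk-zero G h₀ = walk-edge F e
  walk-lift (suc j) {a} h with walk-uncons G (suc j) h
  ... | w , e , h′ with φ-onto (P-closed 1 (φ-in-P a) (walk-edge G e))
  ...   | x , refl = walk-cons F (suc j) e (walk-lift j h′)

  walk-F : ∀ j a b → walk F (suc j) a b ≡ walk G (suc j) (φ a) (φ b)
  walk-F j a b = T-ext (walk-project (suc j)) (walk-lift j)

  walkBelow-F : ∀ {a b} → ⌊ a ≟ b ⌋ ≡ ⌊ φ a ≟ φ b ⌋ →
                ∀ j → walkBelow F j a b ≡ walkBelow G j (φ a) (φ b)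
  walkBelow-F same zero          = refl
  walkBelow-F same (suc zero)    = cong (false ∨_) same
  walkBelow-F {a} {b} same (suc (suc j)) =
    cong₂ _∨_ (walkBelow-F same (suc j)) (walk-F j a b)

  distIs-F : ∀ m → NoClosedWalk G (suc m) → ∀ a b → distIs F a b (suc m) ≡ distIs G (φ a) (φ b) (suc m)
  distIs-F m noClosed a b with walk G (suc m) (φ a) (φ b) in eq
  ... | false = cong (_∧ not (walkBelow F (suc m) a b)) (trans (walk-F m a b) eq)
  ... | true  = cong₂ (λ x y → x ∧ not y) (trans (walk-F m a b) eq) (walkBelow-F same (suc m))
    where
    distinct : ¬ φ a ≡ φ b
    distinct φa≡φb = noClosed (φ b) (subst (λ x → T (walk G (suc m) x (φ b))) φa≡φb (subst T (sym eq) tt))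
    same : ⌊ a ≟ b ⌋ ≡ ⌊ φ a ≟ φ b ⌋
    same = trans (≟-false (distinct ∘ cong φ)) (sym (≟-false distinct))

  nbhdSize-F : ∀ m → NoClosedWalk G (suc m) → ∀ a →
               nbhdSize F (suc m) a ≡ suc k * nbhdSize G (suc m) (φ a)
  nbhdSize-F m noClosed a = begin
    countFin (λ b → distIs F a b (suc m))                   ≡⟨ count-cong (distIs-F m noClosed a) ⟩
    countFin (λ b → distIs G (φ a) (φ b) (suc m))           ≡⟨ count-copies (λ w → distIs G (φ a) w (suc m)) ⟩
    suc k * countFin (λ w → P w ∧ distIs G (φ a) w (suc m)) ≡⟨ cong (suc k *_) (count-cong inP) ⟩
    suc k * nbhdSize G (suc m) (φ a)                        ∎
    where
    open ≡-Reasoning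
    inP : ∀ w → (P w ∧ distIs G (φ a) w (suc m)) ≡ distIs G (φ a) w (suc m)
    inP w = T-ext (proj₂ ∘ to (T-∧ {P w}))
                  (λ d → from T-∧ (P-closed (suc m) (φ-in-P a) (proj₁ (to (T-∧ {walk G (suc m) (φ a) w}) d)) , d))

  noSatisfactory-F : Loopless G → NoDigons G → NoSatisfactoryVertex G → NoSatisfactoryVertex F
  noSatisfactory-F loopless noDigons noSat a sat =
    noSat (φ a) (*-cancelˡ-≤ (suc k)
      (subst₂ _≤_ (nbhdSize-F 0 (loopless-closed loopless) a) (nbhdSize-F 1 (noDigons-closed noDigons) a) sat))

  -- Every vertex of G has an out-neighbour (|N₁| > |N₂| ≥ 0); stepping to it
  -- first gives walks of positive length, which lift to F.
  strong-F : (∀ {u v} → T (P u) → T (P v) → ∃ λ k → T (walk G k u v)) →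
             NoSatisfactoryVertex G → StronglyConnected F
  strong-F P-strong noSat a b
    with count-witness (λ w → distIs G (φ a) w 1) (≤-trans (s≤s z≤n) (≰⇒> (noSat (φ a))))
  ... | w , dist1 with proj₁ (to (T-∧ {walk G 1 (φ a) w}) dist1)
  ...   | step with P-strong (P-closed 1 (φ-in-P a) step) (φ-in-P b)
  ...     | j , h = suc j , walk-lift j (walk-concat G 1 j step h)

  admissible-F : Loopless G → NoDigons G → 1 ≤ countFin P → Admissible F
  admissible-F loopless noDigons nonemptyP =
    subst (1 ≤_) (sym size-F) (*-mono-≤ {1} {suc k} (s≤s z≤n) nonemptyP) ,
    (λ a → loopless (φ a)) ,
    (λ a b → noDigons (φ a) (φ b))

theorem4 : (∃ λ G → Admissible G × NoSatisfactoryVertex G) →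
    Σ (ℕ → Digraph) λ F →
      (∀ i → Admissible (F i) × StronglyConnected (F i) × NoSatisfactoryVertex (F i)) ×
      (∀ i j → ¬ i ≡ j → ¬ Isomorphic (F i) (F j))
theorem4 (G , (nonempty , loopless , noDigons) , noSat) =
  F ,
  (λ i → admissible-F i loopless noDigons nonemptyP , strong-F i P-strong noSat ,
         noSatisfactory-F i loopless noDigons noSat) ,
  nonIsomorphic
  where
  open SinkComponent G (fromℕ< nonempty)
  open BlowUp G P P-closed

  nonemptyP : 1 ≤ countFin P
  nonemptyP = count-pos P r r∈P

  -- The members have pairwise different sizes suc i · |P|.
  nonIsomorphic : ∀ i j → ¬ i ≡ j → ¬ Isomorphic (F i) (F j)
  nonIsomorphic i j i≢j (f , _) =
    i≢j (suc-injective (*-cancelʳ-≡ (suc i) (suc j) (countFin P) {{>-nonZero nonemptyP}}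
      (trans (sym (size-F i)) (trans (↔⇒≡ f) (size-F j)))))
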